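{- Let $P$ be a pattern in which every loop has multiplicity $c$. Then for every positive integer $s$, \[ \Sigma_P(s)\le\Big\lfloor \sigma_P\frac{s^2}{2}-\frac{cs}{2}\Big\rfloor. \]
   Context: A multigraph is a finite vertex set with non-negative integer multiplicities $w(uv)$ on pairs; $e(G)$ is the sum of all multiplicities. A pattern $P$ on a finite set $V(P)$ assigns non-negative integer multiplicities $P(\{v\})$ to vertices (loops) and $P(\{u,v\})$ to pairs. A blow-up of $P$ on $[s]$ is a multigraph on $[s]$ with a map $f\colon[s]\to V(P)$ (not necessarily surjective) such that $w(vv')=P(\{f(v),f(v')\})$ for distinct $v,v'$ (a loop multiplicity if $f(v)=f(v')$); $\Sigma_P(s)$ is the maximum of $e(G)$ over such blow-ups. $A_P$ is the symmetric $V(P)\times V(P)$ matrix with $(A_P)_{uv}=P(\{u,v\})$ (diagonal = loop multiplicities) and $\sigma_P=\max\{\mathbf x^TA_P\mathbf x:\mathbf x\in\mathbb{R}^{V(P)}_{\ge0},\sum_vx_v=1\}$. -}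

module Defs where

open import Data.Nat as ℕ using (ℕ; zero; suc; _<ᵇ_)
open import Data.Fin using (Fin; zero; suc; toℕ)
open import Data.Bool using (if_then_else_)
open import Data.Integer as ℤ using (ℤ; +_)
open import Data.Rational as ℚ using (ℚ; _/_; 0ℚ; 1ℚ; floor)
open import Relation.Binary.PropositionalEquality using (_≡_; _≢_)

-- A pattern on the vertex set V(P) = Fin k, given by its symmetric
-- multiplicity matrix A_P: (A u v) = P({u,v}) for u ≠ v and
-- (A v v) = P({v}) is the loop multiplicity.
record Pattern (k : ℕ) : Set where
  field
    A   : Fin k → Fin k → ℕ
    sym : ∀ u v → A u v ≡ A v u
open Pattern public

-- A multigraph on vertex set [s] = Fin s: multiplicity w i j of the pair {i,j}
-- (only i ≠ j is meaningful).
record Multigraph (s : ℕ) : Set where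
  field
    w   : Fin s → Fin s → ℕ
    sym : ∀ i j → w i j ≡ w j i
open Multigraph public

sumℕ : (n : ℕ) → (Fin n → ℕ) → ℕ
sumℕ zero    f = 0
sumℕ (suc n) f = f zero ℕ.+ sumℕ n (λ i → f (suc i))

sumℚ : (n : ℕ) → (Fin n → ℚ) → ℚ
sumℚ zero    f = 0ℚ
sumℚ (suc n) f = f zero ℚ.+ sumℚ n (λ i → f (suc i))

edges : ∀ {s} → Multigraph s → ℕ
edges {s} G = sumℕ s (λ i → sumℕ s (λ j → if toℕ i <ᵇ toℕ j then w G i j else 0))

IsBlowUp : ∀ {k s} → Pattern k → Multigraph s → (Fin s → Fin k) → Set
IsBlowUp P G f = ∀ i j → i ≢ j → w G i j ≡ A P (f i) (f j)

AllLoops : ∀ {k} → Pattern k → ℕ → Set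
AllLoops {k} P c = ∀ (v : Fin k) → A P v v ≡ c

ℕtoℚ : ℕ → ℚ
ℕtoℚ n = + n / 1

quadForm : ∀ {k} → Pattern k → (Fin k → ℚ) → ℚ
quadForm {k} P x = sumℚ k (λ u → sumℚ k (λ v → ℕtoℚ (A P u v) ℚ.* x u ℚ.* x v))

InSimplex : ∀ {k} → (Fin k → ℚ) → Set
InSimplex {k} x = (∀ v → 0ℚ ℚ.≤ x v) Data.Product.× (sumℚ k x ≡ 1ℚ)
  where import Data.Product

UpperBoundσ : ∀ {k} → Pattern k → ℚ → Set
UpperBoundσ {k} P σ = ∀ (x : Fin k → ℚ) → InSimplex x → quadForm P x ℚ.≤ σ

bound : ℚ → ℕ → ℕ → ℤ
bound σ c s = floor (σ ℚ.* (+ (s ℕ.* s) / 2) ℚ.- (+ (c ℕ.* s) / 2))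

{-# OPTIONS --safe #-}
-- Let n_u be the number of vertices of G that f maps to u. Summing A_P (f i) (f j) over all
-- ordered pairs (i, j) counts every edge of G twice and the loop c once on each of the s
-- diagonal pairs, while grouping the pairs by their images gives the sum of A_P u v n_u n_v.
-- Hence 2 e(G) + c s = s² xᵀ A_P x for the point x = n / s of the simplex, which is at most
-- σ s²; and since e(G) is an integer it is at most the floor of σ s²/2 − c s/2.
module Submission where

open import Defs hiding (sym)
open import Data.Nat using (ℕ)
open import Data.Fin using (Fin)
open import Data.Rational as ℚ using (ℚ)
open import Data.Nat.Properties using (+-*-semiring)
open import Algebra.Properties.Semiring.Sum +-*-semiring
  using (sum; sum-syntax; sum-cong-≗; sum-replicate-zero; ∑-distrib-+; ∑-comm; *-distribˡ-sum; *-distribʳ-sum)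

module Counting where

  open import Data.Nat using (zero; suc; _+_; _*_; _<ᵇ_)
  open import Data.Nat.Properties
    using (+-identityʳ; *-identityˡ; *-identityʳ; *-zeroʳ; <ᵇ-reflects-<; <-asym; ≮⇒≥; ≤-antisym)
  open import Data.Fin using (zero; suc; toℕ)
  open import Data.Fin.Properties using (toℕ-injective; <⇒≢)
  open import Data.Bool using (true; false; if_then_else_)
  open import Relation.Nullary.Reflects using (ofʸ; ofⁿ)
  open import Relation.Nullary.Negation using (contradiction)
  open import Relation.Binary.PropositionalEquality
    using (_≡_; _≢_; refl; sym; trans; cong; cong₂; ≢-sym; module ≡-Reasoning)
  open ≡-Reasoning

  sumℕ≡sum : ∀ n (g : Fin n → ℕ) → sumℕ n g ≡ sum g
  sumℕ≡sum zero    g = refl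
  sumℕ≡sum (suc n) g = cong (g zero +_) (sumℕ≡sum n (λ i → g (suc i)))

  sum-const : ∀ n c → ∑[ i < n ] c ≡ n * c
  sum-const zero    c = refl
  sum-const (suc n) c = cong (c +_) (sum-const n c)

  δ : ∀ {n} → Fin n → Fin n → ℕ
  δ zero    zero    = 1
  δ zero    (suc _) = 0
  δ (suc _) zero    = 0
  δ (suc i) (suc j) = δ i j

  δ-diag : ∀ {n} (i : Fin n) → δ i i ≡ 1
  δ-diag zero    = refl
  δ-diag (suc i) = δ-diag i

  δ-≢ : ∀ {n} {i j : Fin n} → i ≢ j → δ i j ≡ 0
  δ-≢ {i = zero}  {zero}  i≢j = contradiction refl i≢j
  δ-≢ {i = zero}  {suc j} i≢j = refl
  δ-≢ {i = suc i} {zero}  i≢j = refl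
  δ-≢ {i = suc i} {suc j} i≢j = δ-≢ (λ i≡j → i≢j (cong suc i≡j))

  ∑-*δ : ∀ {n} (g : Fin n → ℕ) (i : Fin n) → ∑[ j < n ] (g j * δ i j) ≡ g i
  ∑-*δ {suc n} g zero = begin
    g zero * 1 + ∑[ j < n ] (g (suc j) * 0)
      ≡⟨ cong₂ _+_ (*-identityʳ (g zero)) (sum-cong-≗ (λ j → *-zeroʳ (g (suc j)))) ⟩
    g zero + ∑[ j < n ] 0
      ≡⟨ cong (g zero +_) (sum-replicate-zero n) ⟩
    g zero + 0
      ≡⟨ +-identityʳ (g zero) ⟩
    g zero
      ∎
  ∑-*δ g (suc i) rewrite *-zeroʳ (g zero) = ∑-*δ (λ j → g (suc j)) i

  fibreSize : ∀ {s k} → (Fin s → Fin k) → Fin k → ℕ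
  fibreSize {s} f u = ∑[ i < s ] δ (f i) u

  sum-fibres : ∀ {s k} (f : Fin s → Fin k) (h : Fin k → ℕ) →
               ∑[ i < s ] h (f i) ≡ ∑[ u < k ] (h u * fibreSize f u)
  sum-fibres {s} {k} f h = begin
    ∑[ i < s ] h (f i)                       ≡⟨ sum-cong-≗ (λ i → ∑-*δ h (f i)) ⟨
    ∑[ i < s ] ∑[ u < k ] (h u * δ (f i) u)  ≡⟨ ∑-comm (λ i u → h u * δ (f i) u) ⟩
    ∑[ u < k ] ∑[ i < s ] (h u * δ (f i) u)  ≡⟨ sum-cong-≗ (λ u → *-distribˡ-sum (h u) (λ i → δ (f i) u)) ⟨
    ∑[ u < k ] (h u * fibreSize f u)         ∎

  sum-fibreSize : ∀ {s k} (f : Fin s → Fin k) → ∑[ u < k ] fibreSize f u ≡ s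
  sum-fibreSize {s} {k} f = begin
    ∑[ u < k ] fibreSize f u        ≡⟨ sum-cong-≗ (λ u → *-identityˡ (fibreSize f u)) ⟨
    ∑[ u < k ] (1 * fibreSize f u)  ≡⟨ sum-fibres f (λ _ → 1) ⟨
    ∑[ i < s ] 1                    ≡⟨ sum-const s 1 ⟩
    s * 1                           ≡⟨ *-identityʳ s ⟩
    s                               ∎

  sum²-fibres : ∀ {s k} (f : Fin s → Fin k) (g : Fin k → Fin k → ℕ) →
    ∑[ i < s ] ∑[ j < s ] g (f i) (f j) ≡ ∑[ u < k ] ∑[ v < k ] (g u v * fibreSize f u * fibreSize f v)
  sum²-fibres {s} {k} f g = begin
    ∑[ i < s ] ∑[ j < s ] g (f i) (f j)        ≡⟨ sum-fibres f (λ u → ∑[ j < s ] g u (f j)) ⟩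
    ∑[ u < k ] ((∑[ j < s ] g u (f j)) * n u)  ≡⟨ sum-cong-≗ (λ u → *-distribʳ-sum (n u) (λ j → g u (f j))) ⟩
    ∑[ u < k ] ∑[ j < s ] (g u (f j) * n u)    ≡⟨ sum-cong-≗ (λ u → sum-fibres f (λ v → g u v * n u)) ⟩
    ∑[ u < k ] ∑[ v < k ] (g u v * n u * n v)  ∎
    where
    n : Fin k → ℕ
    n = fibreSize f

  upper : ∀ {n} → (Fin n → Fin n → ℕ) → Fin n → Fin n → ℕ
  upper M i j = if toℕ i <ᵇ toℕ j then M i j else 0

  upperSum : ∀ {n} → (Fin n → Fin n → ℕ) → ℕ
  upperSum {n} M = ∑[ i < n ] ∑[ j < n ] upper M i j

  edges≡upperSum : ∀ {s} (G : Multigraph s) → edges G ≡ upperSum (w G)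
  edges≡upperSum {s} G = trans (sumℕ≡sum s _) (sum-cong-≗ (λ i → sumℕ≡sum s (upper (w G) i)))

  upper-cong : ∀ {n} {M N : Fin n → Fin n → ℕ} → (∀ i j → i ≢ j → M i j ≡ N i j) →
               ∀ i j → upper M i j ≡ upper N i j
  upper-cong M≡N i j with toℕ i <ᵇ toℕ j | <ᵇ-reflects-< (toℕ i) (toℕ j)
  ... | true  | ofʸ i<j = M≡N i j (<⇒≢ i<j)
  ... | false | _       = refl

  upper-decomposition : ∀ {n} (M : Fin n → Fin n → ℕ) → (∀ i j → M i j ≡ M j i) →
                        ∀ i j → M i j ≡ upper M i j + upper M j i + M i j * δ i j
  upper-decomposition M M-sym i j
    with toℕ i <ᵇ toℕ j | <ᵇ-reflects-< (toℕ i) (toℕ j) | toℕ j <ᵇ toℕ i | <ᵇ-reflects-< (toℕ j) (toℕ i)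
  ... | true  | ofʸ i<j | true  | ofʸ j<i = contradiction j<i (<-asym i<j)
  ... | true  | ofʸ i<j | false | _
    rewrite δ-≢ (<⇒≢ i<j) | *-zeroʳ (M i j) = sym (trans (+-identityʳ _) (+-identityʳ _))
  ... | false | _       | true  | ofʸ j<i
    rewrite δ-≢ (≢-sym (<⇒≢ j<i)) | *-zeroʳ (M i j) = trans (M-sym i j) (sym (+-identityʳ _))
  ... | false | ofⁿ i≮j | false | ofⁿ j≮i
    with refl ← toℕ-injective (≤-antisym (≮⇒≥ j≮i) (≮⇒≥ i≮j))
    rewrite δ-diag i = sym (*-identityʳ (M i i))

  sum-symmetric : ∀ {n} (M : Fin n → Fin n → ℕ) → (∀ i j → M i j ≡ M j i) →
                  ∑[ i < n ] ∑[ j < n ] M i j ≡ upperSum M + upperSum M + ∑[ i < n ] M i i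
  sum-symmetric {n} M M-sym = begin
    ∑[ i < n ] ∑[ j < n ] M i j
      ≡⟨ sum-cong-≗ (λ i → sum-cong-≗ (upper-decomposition M M-sym i)) ⟩
    ∑[ i < n ] ∑[ j < n ] (U i j + U j i + M i j * δ i j)
      ≡⟨ sum-cong-≗ (λ i → ∑-distrib-+ (λ j → U i j + U j i) (λ j → M i j * δ i j)) ⟩
    ∑[ i < n ] (∑[ j < n ] (U i j + U j i) + ∑[ j < n ] (M i j * δ i j))
      ≡⟨ sum-cong-≗ (λ i → cong₂ _+_ (∑-distrib-+ (U i) (λ j → U j i)) (∑-*δ (M i) i)) ⟩
    ∑[ i < n ] (∑[ j < n ] U i j + ∑[ j < n ] U j i + M i i)
      ≡⟨ ∑-distrib-+ (λ i → ∑[ j < n ] U i j + ∑[ j < n ] U j i) (λ i → M i i) ⟩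
    ∑[ i < n ] (∑[ j < n ] U i j + ∑[ j < n ] U j i) + ∑[ i < n ] M i i
      ≡⟨ cong (_+ ∑[ i < n ] M i i) (∑-distrib-+ (λ i → ∑[ j < n ] U i j) (λ i → ∑[ j < n ] U j i)) ⟩
    upperSum M + ∑[ i < n ] ∑[ j < n ] U j i + ∑[ i < n ] M i i
      ≡⟨ cong (λ t → upperSum M + t + ∑[ i < n ] M i i) (∑-comm (λ i j → U j i)) ⟩
    upperSum M + upperSum M + ∑[ i < n ] M i i
      ∎
    where
    U : Fin n → Fin n → ℕ
    U = upper M

  sum-blowUp : ∀ {k s} (P : Pattern k) {c} → AllLoops P c →
               (G : Multigraph s) (f : Fin s → Fin k) → IsBlowUp P G f →
               ∑[ i < s ] ∑[ j < s ] A P (f i) (f j) ≡ edges G + edges G + s * c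
  sum-blowUp {s = s} P {c} loops G f blowUp = begin
    ∑[ i < s ] ∑[ j < s ] M i j                 ≡⟨ sum-symmetric M (λ i j → Pattern.sym P (f i) (f j)) ⟩
    upperSum M + upperSum M + ∑[ i < s ] M i i  ≡⟨ cong₂ _+_ (cong₂ _+_ upperSum≡edges upperSum≡edges) diagonal ⟩
    edges G + edges G + s * c                   ∎
    where
    M : Fin s → Fin s → ℕ
    M i j = A P (f i) (f j)
    upperSum≡edges : upperSum M ≡ edges G
    upperSum≡edges = begin
      upperSum M      ≡⟨ sum-cong-≗ (λ i → sum-cong-≗ (upper-cong (λ i j i≢j → sym (blowUp i j i≢j)) i)) ⟩
      upperSum (w G)  ≡⟨ edges≡upperSum G ⟨
      edges G         ∎
    diagonal : ∑[ i < s ] M i i ≡ s * c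
    diagonal = trans (sum-cong-≗ (λ i → loops (f i))) (sum-const s c)

module Rationals where

  open import Data.Nat as ℕ using (zero; suc)
  open import Data.Nat.Coprimality using (1-coprimeTo) renaming (sym to coprime-sym)
  open import Data.Integer as ℤ using (+_)
  import Data.Integer.Properties as ℤ
  open import Data.Integer.DivMod using (div-pos-is-/ℕ; n<s[n/ℕd]*d)
  open import Data.Rational
    using (mkℚ; _/_; _+_; _-_; _*_; _≤_; -_; 1/_; ½; 0ℚ; 1ℚ; floor; NonZero; Positive; NonNegative; *≤*)
  open import Data.Rational.Properties
    using (normalize-coprime; normalize-pos; normalize-nonNeg; /-cong; pos⇒nonZero; pos⇒nonNeg; 1/pos⇒pos;
           nonNeg*nonNeg⇒nonNeg; nonNegative⁻¹; *-inverseˡ; *-inverseʳ; *-assoc; *-identityˡ; *-zeroʳ;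
           *-distribˡ-+; *-monoˡ-≤-nonNeg; *-monoʳ-≤-nonNeg; +-monoˡ-≤; module ≤-Reasoning)
  import Data.Rational.Solver as Solver
  open Solver.+-*-Solver using (solve; _:+_; _:-_; _:*_; _:=_; con)
  open import Data.Fin using (zero; suc)
  open import Data.Product using (_,_)
  open import Relation.Binary.PropositionalEquality
    using (_≡_; refl; sym; trans; cong; cong₂; subst; module ≡-Reasoning)

  -- ℕtoℚ n normalises through gcd n 1, which is stuck for a variable n; the coprime form computes.
  ℕtoℚ≡mkℚ : ∀ n → ℕtoℚ n ≡ mkℚ (+ n) 0 (coprime-sym (1-coprimeTo n))
  ℕtoℚ≡mkℚ n = normalize-coprime (coprime-sym (1-coprimeTo n))

  ℕtoℚ-+ : ∀ m n → ℕtoℚ (m ℕ.+ n) ≡ ℕtoℚ m + ℕtoℚ n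
  ℕtoℚ-+ m n = trans (/-cong numerators refl) (sym (cong₂ _+_ (ℕtoℚ≡mkℚ m) (ℕtoℚ≡mkℚ n)))
    where
    numerators : + (m ℕ.+ n) ≡ + m ℤ.* + 1 ℤ.+ + n ℤ.* + 1
    numerators = trans (ℤ.pos-+ m n) (sym (cong₂ ℤ._+_ (ℤ.*-identityʳ (+ m)) (ℤ.*-identityʳ (+ n))))

  ℕtoℚ-* : ∀ m n → ℕtoℚ (m ℕ.* n) ≡ ℕtoℚ m * ℕtoℚ n
  ℕtoℚ-* m n = trans (/-cong (ℤ.pos-* m n) refl) (sym (cong₂ _*_ (ℕtoℚ≡mkℚ m) (ℕtoℚ≡mkℚ n)))

  /2≡ℕtoℚ*½ : ∀ m → + m / 2 ≡ ℕtoℚ m * ½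
  /2≡ℕtoℚ*½ m = trans (/-cong (sym (ℤ.*-identityʳ (+ m))) refl) (sym (cong (_* ½) (ℕtoℚ≡mkℚ m)))

  ℕtoℚ-pos : ∀ n .{{_ : ℕ.NonZero n}} → Positive (ℕtoℚ n)
  ℕtoℚ-pos n = normalize-pos n 1

  ℕtoℚ-nonNeg : ∀ n → NonNegative (ℕtoℚ n)
  ℕtoℚ-nonNeg n = normalize-nonNeg n 1

  ℕtoℚ-≤⇒≤-floor : ∀ m q → ℕtoℚ m ≤ q → + m ℤ.≤ floor q
  ℕtoℚ-≤⇒≤-floor m q@(mkℚ num d _) m≤q
    with *≤* m*d≤num*1 ← subst (_≤ q) (ℕtoℚ≡mkℚ m) m≤q = begin
      + m               ≤⟨ ℤ.i<j⇒i≤pred[j] m<1+Q ⟩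
      ℤ.pred (ℤ.suc Q)  ≡⟨ ℤ.pred-suc Q ⟩
      Q                 ≡⟨ div-pos-is-/ℕ num (suc d) ⟨
      floor q           ∎
    where
    open ℤ.≤-Reasoning
    Q : ℤ.ℤ
    Q = num ℤ./ℕ suc d
    m<1+Q : + m ℤ.< ℤ.suc Q
    m<1+Q = ℤ.*-cancelʳ-<-nonNeg (+ suc d)
      (ℤ.≤-<-trans (subst (+ m ℤ.* + suc d ℤ.≤_) (ℤ.*-identityʳ num) m*d≤num*1) (n<s[n/ℕd]*d num (suc d)))

  sumℚ-cong : ∀ n {g h : Fin n → ℚ} → (∀ i → g i ≡ h i) → sumℚ n g ≡ sumℚ n h
  sumℚ-cong zero    g≡h = refl
  sumℚ-cong (suc n) g≡h = cong₂ _+_ (g≡h zero) (sumℚ-cong n (λ i → g≡h (suc i)))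

  sumℚ-*ˡ : ∀ n t (g : Fin n → ℚ) → sumℚ n (λ i → t * g i) ≡ t * sumℚ n g
  sumℚ-*ˡ zero    t g = sym (*-zeroʳ t)
  sumℚ-*ˡ (suc n) t g =
    trans (cong (_+_ (t * g zero)) (sumℚ-*ˡ n t (λ i → g (suc i)))) (sym (*-distribˡ-+ t (g zero) _))

  sumℚ-ℕtoℚ : ∀ n (g : Fin n → ℕ) → sumℚ n (λ i → ℕtoℚ (g i)) ≡ ℕtoℚ (sum g)
  sumℚ-ℕtoℚ zero    g = refl
  sumℚ-ℕtoℚ (suc n) g =
    trans (cong (_+_ (ℕtoℚ (g zero))) (sumℚ-ℕtoℚ n (λ i → g (suc i)))) (sym (ℕtoℚ-+ (g zero) _))

  quadForm-ℕtoℚ : ∀ {k} (P : Pattern k) (y : Fin k → ℕ) →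
    quadForm P (λ u → ℕtoℚ (y u)) ≡ ℕtoℚ (∑[ u < k ] ∑[ v < k ] (A P u v ℕ.* y u ℕ.* y v))
  quadForm-ℕtoℚ {k} P y = begin
    quadForm P (λ u → ℕtoℚ (y u))
      ≡⟨ sumℚ-cong k (λ u → sumℚ-cong k (λ v → term u v)) ⟩
    sumℚ k (λ u → sumℚ k (λ v → ℕtoℚ (A P u v ℕ.* y u ℕ.* y v)))
      ≡⟨ sumℚ-cong k (λ u → sumℚ-ℕtoℚ k (λ v → A P u v ℕ.* y u ℕ.* y v)) ⟩
    sumℚ k (λ u → ℕtoℚ (∑[ v < k ] (A P u v ℕ.* y u ℕ.* y v)))
      ≡⟨ sumℚ-ℕtoℚ k (λ u → ∑[ v < k ] (A P u v ℕ.* y u ℕ.* y v)) ⟩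
    ℕtoℚ (∑[ u < k ] ∑[ v < k ] (A P u v ℕ.* y u ℕ.* y v))
      ∎
    where
    open ≡-Reasoning
    term : ∀ u v → ℕtoℚ (A P u v) * ℕtoℚ (y u) * ℕtoℚ (y v) ≡ ℕtoℚ (A P u v ℕ.* y u ℕ.* y v)
    term u v = sym (trans (ℕtoℚ-* (A P u v ℕ.* y u) (y v)) (cong (_* ℕtoℚ (y v)) (ℕtoℚ-* (A P u v) (y u))))

  quadForm-scale : ∀ {k} (P : Pattern k) t (x y : Fin k → ℚ) → (∀ u → y u ≡ t * x u) →
                   quadForm P y ≡ t * t * quadForm P x
  quadForm-scale {k} P t x y y≡tx = begin
    quadForm P y
      ≡⟨ sumℚ-cong k (λ u → sumℚ-cong k (λ v → term u v)) ⟩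
    sumℚ k (λ u → sumℚ k (λ v → t * t * (a u v * x u * x v)))
      ≡⟨ sumℚ-cong k (λ u → sumℚ-*ˡ k (t * t) (λ v → a u v * x u * x v)) ⟩
    sumℚ k (λ u → t * t * sumℚ k (λ v → a u v * x u * x v))
      ≡⟨ sumℚ-*ˡ k (t * t) (λ u → sumℚ k (λ v → a u v * x u * x v)) ⟩
    t * t * quadForm P x
      ∎
    where
    open ≡-Reasoning
    a : Fin k → Fin k → ℚ
    a u v = ℕtoℚ (A P u v)
    term : ∀ u v → a u v * y u * y v ≡ t * t * (a u v * x u * x v)
    term u v rewrite y≡tx u | y≡tx v =
      solve 4 (λ a t p q → a :* (t :* p) :* (t :* q) := t :* t :* (a :* p :* q)) refl (a u v) t (x u) (x v)

  quadForm-ℕ-≤ : ∀ {k} (P : Pattern k) {σ} → UpperBoundσ P σ →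
                 (y : Fin k → ℕ) (s : ℕ) .{{_ : ℕ.NonZero s}} → sum y ≡ s →
                 quadForm P (λ u → ℕtoℚ (y u)) ≤ ℕtoℚ s * ℕtoℚ s * σ
  quadForm-ℕ-≤ {k} P {σ} σ-bound y s Σy≡s = begin
    quadForm P (λ u → ℕtoℚ (y u))  ≡⟨ quadForm-scale P S x (λ u → ℕtoℚ (y u)) y≡Sx ⟩
    S * S * quadForm P x           ≤⟨ *-monoˡ-≤-nonNeg (S * S) (σ-bound x x∈Δ) ⟩
    S * S * σ                      ∎
    where
    open ≤-Reasoning
    S : ℚ
    S = ℕtoℚ s
    instance
      S-pos : Positive S
      S-pos = ℕtoℚ-pos s
      S-nonZero : NonZero S
      S-nonZero = pos⇒nonZero S
      S-nonNeg : NonNegative S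
      S-nonNeg = pos⇒nonNeg S
      S*S-nonNeg : NonNegative (S * S)
      S*S-nonNeg = nonNeg*nonNeg⇒nonNeg S S
      1/S-nonNeg : NonNegative (1/ S)
      1/S-nonNeg = pos⇒nonNeg (1/ S) {{1/pos⇒pos S}}
    x : Fin k → ℚ
    x u = 1/ S * ℕtoℚ (y u)
    y≡Sx : ∀ u → ℕtoℚ (y u) ≡ S * x u
    y≡Sx u = sym (begin-equality
      S * (1/ S * ℕtoℚ (y u))  ≡⟨ *-assoc S (1/ S) (ℕtoℚ (y u)) ⟨
      S * 1/ S * ℕtoℚ (y u)    ≡⟨ cong (_* ℕtoℚ (y u)) (*-inverseʳ S) ⟩
      1ℚ * ℕtoℚ (y u)          ≡⟨ *-identityˡ (ℕtoℚ (y u)) ⟩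
      ℕtoℚ (y u)               ∎)
    x-nonNeg : ∀ u → 0ℚ ≤ x u
    x-nonNeg u = nonNegative⁻¹ (x u) {{nonNeg*nonNeg⇒nonNeg (1/ S) (ℕtoℚ (y u)) {{ℕtoℚ-nonNeg (y u)}}}}
    x∈Δ : InSimplex x
    x∈Δ = x-nonNeg , (begin-equality
      sumℚ k x                          ≡⟨ sumℚ-*ˡ k (1/ S) (λ u → ℕtoℚ (y u)) ⟩
      1/ S * sumℚ k (λ u → ℕtoℚ (y u))  ≡⟨ cong (1/ S *_) (trans (sumℚ-ℕtoℚ k y) (cong ℕtoℚ Σy≡s)) ⟩
      1/ S * S                          ≡⟨ *-inverseˡ S ⟩
      1ℚ                                ∎)

  double-count⇒≤-bound : ∀ e σ c s → ℕtoℚ (e ℕ.+ e ℕ.+ s ℕ.* c) ≤ ℕtoℚ s * ℕtoℚ s * σ →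
                         + e ℤ.≤ bound σ c s
  double-count⇒≤-bound e σ c s count≤ = ℕtoℚ-≤⇒≤-floor e _ (begin
    E
      ≡⟨ solve 2 (λ e b → e := (e :+ e :+ b :- b) :* con ½) refl E (S * C) ⟩
    (E + E + S * C - S * C) * ½
      ≡⟨ cong (λ t → (t - S * C) * ½) count-cast ⟨
    (ℕtoℚ (e ℕ.+ e ℕ.+ s ℕ.* c) - S * C) * ½
      ≤⟨ *-monoʳ-≤-nonNeg ½ (+-monoˡ-≤ (- (S * C)) count≤) ⟩
    (S * S * σ - S * C) * ½
      ≡⟨ solve 4 (λ s c σ h → (s :* s :* σ :- s :* c) :* h := σ :* (s :* s :* h) :- c :* s :* h) refl S C σ ½ ⟩
    σ * (S * S * ½) - C * S * ½
      ≡⟨ cong₂ (λ a b → σ * a - b) (half s s) (half c s) ⟨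
    σ * (+ (s ℕ.* s) / 2) - + (c ℕ.* s) / 2
      ∎)
    where
    open ≤-Reasoning
    E S C : ℚ
    E = ℕtoℚ e
    S = ℕtoℚ s
    C = ℕtoℚ c
    count-cast : ℕtoℚ (e ℕ.+ e ℕ.+ s ℕ.* c) ≡ E + E + S * C
    count-cast = trans (ℕtoℚ-+ (e ℕ.+ e) (s ℕ.* c)) (cong₂ _+_ (ℕtoℚ-+ e e) (ℕtoℚ-* s c))
    half : ∀ m n → + (m ℕ.* n) / 2 ≡ ℕtoℚ m * ℕtoℚ n * ½
    half m n = trans (/2≡ℕtoℚ*½ (m ℕ.* n)) (cong (_* ½) (ℕtoℚ-* m n))

open Counting
open Rationals
open import Data.Nat using (NonZero; _+_; _*_)
open import Data.Integer using (+_; _≤_)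
open import Data.Rational.Properties using (module ≤-Reasoning)
open import Relation.Binary.PropositionalEquality using (cong)

lemma3p1 : ∀ {k : ℕ} (P : Pattern k) (c : ℕ) → AllLoops P c →
    ∀ (σ : ℚ) → UpperBoundσ P σ →
    ∀ (s : ℕ) → .{{_ : NonZero s}} →
    ∀ (G : Multigraph s) (f : Fin s → Fin k) → IsBlowUp P G f →
    + edges G ≤ bound σ c s
lemma3p1 {k} P c loops σ σ-bound s G f blowUp = double-count⇒≤-bound (edges G) σ c s (begin
  ℕtoℚ (edges G + edges G + s * c)
    ≡⟨ cong ℕtoℚ (sum-blowUp P loops G f blowUp) ⟨
  ℕtoℚ (∑[ i < s ] ∑[ j < s ] A P (f i) (f j))
    ≡⟨ cong ℕtoℚ (sum²-fibres f (A P)) ⟩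
  ℕtoℚ (∑[ u < k ] ∑[ v < k ] (A P u v * fibreSize f u * fibreSize f v))
    ≡⟨ quadForm-ℕtoℚ P (fibreSize f) ⟨
  quadForm P (λ u → ℕtoℚ (fibreSize f u))
    ≤⟨ quadForm-ℕ-≤ P σ-bound (fibreSize f) s (sum-fibreSize f) ⟩
  ℕtoℚ s ℚ.* ℕtoℚ s ℚ.* σ
    ∎)
  where
  open ≤-Reasoning
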